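{- Let $G$ be an oriented graph derived from a Burling tree $(T,r,\ell,c)$. Then $G$ can be derived from a Burling tree $(T',r',\ell',c')$ such that for every $v$, $v\in V(G)$ if and only if $v$ is neither the root nor a last-born of $T'$. Moreover, for every arc $uv$ of $G$, $uv$ is a top arc (resp. bottom arc) of $G$ with respect to $T$ if and only if it is a top arc (resp. bottom arc) of $G$ with respect to $T'$.
   Context: Rooted trees: for a rooted tree $(T,r)$ and $v\neq r$, $p(v)$ is the parent of $v$. A branch is a path $v_1v_2\dots v_k$ of $T$ with $v_i$ the parent of $v_{i+1}$ for all $i$ (it starts at $v_1$); a branch may be empty. A Burling tree is a 4-tuple $(T,r,\ell,c)$ where $T$ is a rooted tree with root $r$; $\ell$ assigns to every non-leaf vertex $v$ one of its children $\ell(v)$, the last-born of $v$; and $c$ is a function on $V(T)$ such that if $v\neq r$ is not a last-born then $c(v)$ is the vertex set of a (possibly empty) branch of $T$ starting at $\ell(p(v))$, while $c(v)=\varnothing$ if $v$ is the root or a last-born. The oriented graph fully derived from the Burling tree has vertex set $V(T)$ and an arc $uv$ iff $v\in c(u)$. An oriented graph $G$ is derived from the Burling tree if it is an induced subgraph of the fully derived oriented graph (so $V(G)\subseteq V(T)$). For such $G$ and an arc $uv$ of $G$, all out-neighbours of $u$ in $G$ lie on the branch $c(u)$; $uv$ is a top arc with respect to $T$ if $v$ is the out-neighbour of $u$ in $G$ closest in $T$ to the root, and a bottom arc with respect to $T$ if $v$ is the out-neighbour of $u$ in $G$ furthest in $T$ from the root. -}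

module Defs where

open import Data.Nat using (ℕ; zero; suc; _≤_; _<_)
open import Data.List using (List; []; _∷_)
open import Data.List.Membership.Propositional using (_∈_)
open import Data.Product using (Σ; _×_; ∃)
open import Data.Sum using (_⊎_)
open import Data.Unit using (⊤)
open import Function using (_∘_)
open import Function.Bundles using (_⇔_)
open import Relation.Nullary using (¬_)
open import Relation.Binary.PropositionalEquality using (_≡_; _≢_)

-- Vertices are labelled by natural numbers (so that a new tree may use fresh labels).

iter : (ℕ → ℕ) → ℕ → ℕ → ℕ
iter f zero    x = x
iter f (suc k) x = f (iter f k x)

record RootedTree : Set where
  field
    verts     : List ℕ
    root      : ℕ
    parent    : ℕ → ℕ
    root∈     : root ∈ verts
    parent∈   : ∀ v → v ∈ verts → v ≢ root → parent v ∈ verts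
    reachRoot : ∀ v → v ∈ verts → ∃ λ k → iter parent k v ≡ root

module _ (T : RootedTree) where
  open RootedTree T

  Child : ℕ → ℕ → Set
  Child u v = u ∈ verts × u ≢ root × parent u ≡ v

  NonLeaf : ℕ → Set
  NonLeaf v = v ∈ verts × ∃ λ u → Child u v

  Depth : ℕ → ℕ → Set
  Depth v k = iter parent k v ≡ root × (∀ j → j < k → iter parent j v ≢ root)

  data DownPath : List ℕ → Set where
    single : ∀ {x} → x ∈ verts → DownPath (x ∷ [])
    step   : ∀ {x y xs} → Child y x → DownPath (y ∷ xs) → DownPath (x ∷ y ∷ xs)

  BranchFrom : ℕ → List ℕ → Set
  BranchFrom a []       = ⊤
  BranchFrom a (x ∷ xs) = x ≡ a × DownPath (x ∷ xs)

record BurlingTree : Set where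
  field
    tree     : RootedTree
  open RootedTree tree
  field
    lastBorn : ℕ → ℕ
    lastBorn-child : ∀ v → NonLeaf tree v → Child tree (lastBorn v) v
  IsLastBorn : ℕ → Set
  IsLastBorn v = ∃ λ w → NonLeaf tree w × lastBorn w ≡ v
  field
    c        : ℕ → List ℕ
    c-empty  : ∀ v → v ∈ verts → (v ≡ root ⊎ IsLastBorn v) → c v ≡ []
    c-branch : ∀ v → v ∈ verts → v ≢ root → ¬ IsLastBorn v →
               BranchFrom tree (lastBorn (parent v)) (c v)

record OrientedGraph : Set₁ where
  field
    V      : List ℕ
    Arc    : ℕ → ℕ → Set
    arc-in : ∀ u v → Arc u v → u ∈ V × v ∈ V

open BurlingTree
open RootedTree
open OrientedGraph

-- G is derived from B: G is an induced subgraph of the oriented graph fully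
-- derived from B (arc uv iff v ∈ c(u)).
DerivedFrom : OrientedGraph → BurlingTree → Set
DerivedFrom G B =
  (∀ v → v ∈ V G → v ∈ verts (tree B)) ×
  (∀ u v → u ∈ V G → v ∈ V G → (Arc G u v ⇔ v ∈ c B u))

TopArc : OrientedGraph → BurlingTree → ℕ → ℕ → Set
TopArc G B u v = Arc G u v ×
  (∀ w → Arc G u w → ∀ kv kw → Depth (tree B) v kv → Depth (tree B) w kw → kv ≤ kw)

BottomArc : OrientedGraph → BurlingTree → ℕ → ℕ → Set
BottomArc G B u v = Arc G u v ×
  (∀ w → Arc G u w → ∀ kv kw → Depth (tree B) v kv → Depth (tree B) w kw → kw ≤ kv)

-- Contract T onto the vertices of G.  The new tree T′ has a fresh root N and keeps the
-- ancestor relation between vertices of G; below every anchor (N or a vertex of G) hangs a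
-- chain of last-borns, and a vertex x of G is attached to the chain of its nearest proper
-- G-ancestor at a position growing with its depth.  The list c′(u) is c(u) with its non-G
-- vertices replaced by chain segments, so it is a branch of T′ starting at the right place
-- and containing the out-neighbours of u in the same order as c(u).  Along a branch depth is
-- the position on the branch, hence top and bottom arcs are the same for T and T′.  The
-- vertices of G are the non-root non-last-born vertices of T′ since all chain vertices are
-- last-borns.
module Submission where

open import Defs
open import Data.Nat using (ℕ; zero; suc; _+_; _∸_; _≤_; _<_; z≤n; s≤s; _<?_)
open import Data.Nat.Properties
open import Data.List using (List; []; _∷_; _++_; map; filter; cartesianProductWith; upTo)
open import Data.List.Properties using (filter-++; filter-accept; filter-reject)
open import Data.List.Extrema.Nat using (max; xs≤max)
open import Data.List.Membership.Propositional using (_∈_; _∉_)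
open import Data.List.Membership.Propositional.Properties
  using (∈-++⁺ˡ; ∈-++⁺ʳ; ∈-++⁻; ∈-map⁺; ∈-filter⁺; ∈-filter⁻;
         ∈-cartesianProductWith⁺; ∈-cartesianProductWith⁻; ∈-upTo⁺; ∈-upTo⁻)
open import Data.List.Membership.DecPropositional _≟_ using (_∈?_)
open import Data.List.Relation.Unary.Any using (here; there)
import Data.List.Relation.Unary.All as All
open import Data.Product using (Σ; _×_; _,_; proj₁; proj₂; ∃)
open import Data.Sum using (_⊎_; inj₁; inj₂)
open import Data.Unit using (tt)
open import Function using (_∘_; case_of_)
open import Function.Bundles using (_⇔_; mk⇔; Equivalence)
open import Function.Construct.Composition using (_⇔-∘_)
open import Function.Construct.Symmetry using (⇔-sym)
open import Relation.Nullary using (¬_; yes; no; contradiction)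
open import Relation.Unary using (Decidable)
open import Relation.Binary.Definitions using (tri<; tri≈; tri>)
open import Relation.Binary.PropositionalEquality

open Equivalence using (to; from)

iter-suc : ∀ (f : ℕ → ℕ) k x → iter f (suc k) x ≡ iter f k (f x)
iter-suc f zero    x = refl
iter-suc f (suc k) x = cong f (iter-suc f k x)

iter-+ : ∀ (f : ℕ → ℕ) m n x → iter f (m + n) x ≡ iter f m (iter f n x)
iter-+ f zero    n x = refl
iter-+ f (suc m) n x = cong f (iter-+ f m n x)

iter-cancel : ∀ {f g : ℕ → ℕ} → (∀ y → g (f y) ≡ y) → ∀ n x → iter g n (iter f n x) ≡ x
iter-cancel         gf zero    x = refl
iter-cancel {f} {g} gf (suc n) x = begin
  iter g (suc n) (f (iter f n x)) ≡⟨ iter-suc g n _ ⟩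
  iter g n (g (f (iter f n x)))   ≡⟨ cong (iter g n) (gf _) ⟩
  iter g n (iter f n x)           ≡⟨ iter-cancel gf n x ⟩
  x                               ∎
  where open ≡-Reasoning

data Precedes {A : Set} : List A → A → A → Set where
  here  : ∀ {w v xs} → v ∈ w ∷ xs → Precedes (w ∷ xs) w v
  there : ∀ {x w v xs} → Precedes xs w v → Precedes (x ∷ xs) w v

module _ {A : Set} where

  precedes-total : ∀ {v w : A} {xs} → v ∈ xs → w ∈ xs → Precedes xs v w ⊎ Precedes xs w v
  precedes-total (here refl) w∈          = inj₁ (here w∈)
  precedes-total (there v∈)  (here refl) = inj₂ (here (there v∈))
  precedes-total (there v∈)  (there w∈) with precedes-total v∈ w∈
  ... | inj₁ p = inj₁ (there p)
  ... | inj₂ p = inj₂ (there p)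

  module _ {P : A → Set} (P? : Decidable P) where

    precedes-filter⁺ : ∀ {xs w v} → P w → P v → Precedes xs w v → Precedes (filter P? xs) w v
    precedes-filter⁺ {w ∷ xs} {w} {v} pw pv (here v∈) =
      subst (λ ys → Precedes ys w v) (sym (filter-accept P? pw))
        (here (subst (v ∈_) (filter-accept P? pw) (∈-filter⁺ P? v∈ pv)))
    precedes-filter⁺ {x ∷ xs} pw pv (there p) with P? x
    ... | yes _ = there (precedes-filter⁺ pw pv p)
    ... | no _  = precedes-filter⁺ pw pv p

    precedes-filter⁻ : ∀ xs {w v} → Precedes (filter P? xs) w v → Precedes xs w v
    precedes-filter⁻ (x ∷ xs) p with P? x | p
    ... | yes _ | here (here refl) = here (here refl)
    ... | yes _ | here (there v∈)  = here (there (proj₁ (∈-filter⁻ P? v∈)))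
    ... | yes _ | there p′         = there (precedes-filter⁻ xs p′)
    ... | no _  | p′               = there (precedes-filter⁻ xs p′)

    ∈-filter-≡ : ∀ {xs ys v} → filter P? xs ≡ filter P? ys → P v → v ∈ xs → v ∈ ys
    ∈-filter-≡ eq pv v∈ = proj₁ (∈-filter⁻ P? (subst (_ ∈_) eq (∈-filter⁺ P? v∈ pv)))

    precedes-filter-≡ : ∀ {xs ys w v} → filter P? xs ≡ filter P? ys → P w → P v →
                        Precedes xs w v → Precedes ys w v
    precedes-filter-≡ {ys = ys} eq pw pv p =
      precedes-filter⁻ ys (subst (λ zs → Precedes zs _ _) eq (precedes-filter⁺ pw pv p))

module _ (T : RootedTree) where
  open RootedTree T

  Depth-child : ∀ {v k} → v ≢ root → Depth T (parent v) k → Depth T v (suc k)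
  Depth-child {v} {k} v≢root (reach , minimal) =
    trans (iter-suc parent k v) reach ,
    λ { zero    _          → v≢root
      ; (suc j) (s≤s j<k) → minimal j j<k ∘ trans (sym (iter-suc parent j v)) }

  Depth-parent : ∀ {v k} → Depth T v (suc k) → v ≢ root × Depth T (parent v) k
  Depth-parent {v} {k} (reach , minimal) =
    minimal 0 (s≤s z≤n) ,
    trans (sym (iter-suc parent k v)) reach ,
    λ j j<k → minimal (suc j) (s≤s j<k) ∘ trans (iter-suc parent j v)

  Depth-unique : ∀ {v a b} → Depth T v a → Depth T v b → a ≡ b
  Depth-unique {a = a} {b} (reachA , minimalA) (reachB , minimalB) with <-cmp a b
  ... | tri< a<b _ _ = contradiction reachA (minimalB a a<b)
  ... | tri≈ _ a≡b _ = a≡b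
  ... | tri> _ _ b<a = contradiction reachB (minimalA b b<a)

  Depth-exists : ∀ K v → iter parent K v ≡ root → ∃ (Depth T v)
  Depth-exists zero    v reach = 0 , reach , λ _ ()
  Depth-exists (suc K) v reach with v ≟ root
  ... | yes v≡root = 0 , v≡root , λ _ ()
  ... | no  v≢root =
    let k , d = Depth-exists K (parent v) (trans (sym (iter-suc parent K v)) reach)
    in  suc k , Depth-child v≢root d

  Depth-of : ∀ {v} → v ∈ verts → ∃ (Depth T v)
  Depth-of {v} v∈ = let K , reach = reachRoot v v∈ in Depth-exists K v reach

  -- 0 on labels outside the tree.
  depth : ℕ → ℕ
  depth v with v ∈? verts
  ... | yes v∈ = proj₁ (Depth-of v∈)
  ... | no  _  = 0

  depth-Depth : ∀ {v} → v ∈ verts → Depth T v (depth v)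
  depth-Depth {v} v∈ with v ∈? verts
  ... | yes v∈′ = proj₂ (Depth-of v∈′)
  ... | no  v∉  = contradiction v∈ v∉

  Child-parent∈ : ∀ {y x} → Child T y x → x ∈ verts
  Child-parent∈ (y∈ , y≢root , refl) = parent∈ _ y∈ y≢root

  Child-Depth : ∀ {y x k} → Child T y x → Depth T x k → Depth T y (suc k)
  Child-Depth (_ , y≢root , refl) = Depth-child y≢root

  depth-child : ∀ {y x} → Child T y x → depth y ≡ suc (depth x)
  depth-child ch = Depth-unique (depth-Depth (proj₁ ch)) (Child-Depth ch (depth-Depth (Child-parent∈ ch)))

  DownPath-∈ : ∀ {xs v} → DownPath T xs → v ∈ xs → v ∈ verts
  DownPath-∈ (single x∈) (here refl) = x∈
  DownPath-∈ (step ch p) (here refl) = Child-parent∈ ch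
  DownPath-∈ (step ch p) (there v∈) = DownPath-∈ p v∈

  DownPath-Depth-≤ : ∀ {y ys v a b} → DownPath T (y ∷ ys) → Depth T y a → v ∈ y ∷ ys →
                     Depth T v b → a ≤ b
  DownPath-Depth-≤ p           dy (here refl) dv = ≤-reflexive (Depth-unique dy dv)
  DownPath-Depth-≤ (step ch p) dy (there v∈)  dv =
    ≤-trans (n≤1+n _) (DownPath-Depth-≤ p (Child-Depth ch dy) v∈ dv)

  DownPath-Depth-< : ∀ {xs w v a b} → DownPath T xs → Precedes xs w v → w ≢ v →
                     Depth T w a → Depth T v b → a < b
  DownPath-Depth-< p           (here (here refl)) w≢v = contradiction refl w≢v
  DownPath-Depth-< (step ch p) (here (there v∈))  _   dw dv = DownPath-Depth-≤ p (Child-Depth ch dw) v∈ dv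
  DownPath-Depth-< (step _ p)  (there wv)         w≢v = DownPath-Depth-< p wv w≢v

  NoDeeper : ℕ → ℕ → Set
  NoDeeper v w = ∀ kv kw → Depth T v kv → Depth T w kw → kv ≤ kw

  NoDeeper⇔Precedes : ∀ {xs v w} → DownPath T xs → v ∈ xs → w ∈ xs →
                      NoDeeper v w ⇔ Precedes xs v w
  NoDeeper⇔Precedes {xs} {v} {w} p v∈ w∈ = mk⇔ shallower⇒first first⇒shallower
    where
    dv : Depth T v (depth v)
    dv = depth-Depth (DownPath-∈ p v∈)
    dw : Depth T w (depth w)
    dw = depth-Depth (DownPath-∈ p w∈)

    shallower⇒first : NoDeeper v w → Precedes xs v w
    shallower⇒first v≤w with precedes-total v∈ w∈ | w ≟ v
    ... | inj₁ vw | _        = vw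
    ... | inj₂ wv | yes refl = wv
    ... | inj₂ wv | no  w≢v  = contradiction (v≤w _ _ dv dw) (<⇒≱ (DownPath-Depth-< p wv w≢v dw dv))

    first⇒shallower : Precedes xs v w → NoDeeper v w
    first⇒shallower vw _ _ dv′ dw′ with v ≟ w
    ... | yes refl = ≤-reflexive (Depth-unique dv′ dw′)
    ... | no  v≢w  = <⇒≤ (DownPath-Depth-< p vw v≢w dv′ dw′)

BranchFrom-DownPath : ∀ {T a xs v} → BranchFrom T a xs → v ∈ xs → DownPath T xs
BranchFrom-DownPath {xs = _ ∷ _} (_ , p) _ = p

module _ (B : BurlingTree) where
  open BurlingTree B
  open RootedTree tree

  c-nonempty : ∀ {u v} → u ∈ verts → v ∈ c u → u ≢ root × ¬ IsLastBorn u
  c-nonempty {u} {v} u∈ v∈ = (λ u≡root → empty (inj₁ u≡root)) , (λ lb → empty (inj₂ lb))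
    where
    empty : ¬ (u ≡ root ⊎ IsLastBorn u)
    empty h with subst (v ∈_) (c-empty u u∈ h) v∈
    ... | ()

  c-DownPath : ∀ {u v} → u ∈ verts → v ∈ c u → DownPath tree (c u)
  c-DownPath u∈ v∈ =
    let u≢root , ¬lb = c-nonempty u∈ v∈ in BranchFrom-DownPath (c-branch _ u∈ u≢root ¬lb) v∈

NoDeeper⇔Precedes-c : ∀ {G B u v w} → DerivedFrom G B →
                      OrientedGraph.Arc G u v → OrientedGraph.Arc G u w →
                      NoDeeper (BurlingTree.tree B) v w ⇔ Precedes (BurlingTree.c B u) v w
NoDeeper⇔Precedes-c {G} {B} {u} {v} {w} (V⊆ , arc⇔) uv uw =
  NoDeeper⇔Precedes (BurlingTree.tree B) (c-DownPath B (V⊆ u u∈) v∈c) v∈c w∈c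
  where
  u∈ : u ∈ OrientedGraph.V G
  u∈ = proj₁ (OrientedGraph.arc-in G u v uv)
  v∈c : v ∈ BurlingTree.c B u
  v∈c = to (arc⇔ u v u∈ (proj₂ (OrientedGraph.arc-in G u v uv))) uv
  w∈c : w ∈ BurlingTree.c B u
  w∈c = to (arc⇔ u w u∈ (proj₂ (OrientedGraph.arc-in G u w uw))) uw

module _ {G : OrientedGraph} {B B′ : BurlingTree} (D : DerivedFrom G B) (D′ : DerivedFrom G B′)
         (same-order : ∀ {u v w} → OrientedGraph.Arc G u v → OrientedGraph.Arc G u w →
                       Precedes (BurlingTree.c B u) v w ⇔ Precedes (BurlingTree.c B′ u) v w)
         where
  open OrientedGraph G using (Arc)

  NoDeeper-transfer : ∀ {u v w} → Arc u v → Arc u w →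
                      NoDeeper (BurlingTree.tree B) v w ⇔ NoDeeper (BurlingTree.tree B′) v w
  NoDeeper-transfer uv uw =
    ⇔-sym (NoDeeper⇔Precedes-c {G} {B′} D′ uv uw) ⇔-∘
    (same-order uv uw ⇔-∘ NoDeeper⇔Precedes-c {G} {B} D uv uw)

  TopArc-transfer : ∀ {u v} → TopArc G B u v ⇔ TopArc G B′ u v
  TopArc-transfer =
    mk⇔ (λ (uv , top) → uv , λ w uw → to   (NoDeeper-transfer uv uw) (top w uw))
        (λ (uv , top) → uv , λ w uw → from (NoDeeper-transfer uv uw) (top w uw))

  BottomArc-transfer : ∀ {u v} → BottomArc G B u v ⇔ BottomArc G B′ u v
  BottomArc-transfer =
    mk⇔ (λ (uv , bottom) → uv , λ w uw → flip (to   (NoDeeper-transfer uw uv) (flip (bottom w uw))))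
        (λ (uv , bottom) → uv , λ w uw → flip (from (NoDeeper-transfer uw uv) (flip (bottom w uw))))
    where
    flip : ∀ {P Q : ℕ → Set} {R : ℕ → ℕ → Set} →
           (∀ a b → P a → Q b → R b a) → (∀ b a → Q b → P a → R b a)
    flip h b a qb pa = h a b pa qb

module Normalisation (G : OrientedGraph) (B : BurlingTree) (D : DerivedFrom G B) where
  open OrientedGraph G using (V; Arc; arc-in)
  open BurlingTree B using (tree; lastBorn; lastBorn-child; IsLastBorn; c; c-branch)
  open RootedTree tree using (verts; root; parent; parent∈)

  _∈V? : Decidable (_∈ V)
  x ∈V? = x ∈? V

  ∈V⇒∈T : ∀ {v} → v ∈ V → v ∈ verts
  ∈V⇒∈T = proj₁ D _

  N : ℕ
  N = suc (max 0 V)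

  ∈V⇒<N : ∀ {v} → v ∈ V → v < N
  ∈V⇒<N v∈V = s≤s (All.lookup (xs≤max 0 V) v∈V)

  N≤⇒∉V : ∀ {x} → N ≤ x → x ∉ V
  N≤⇒∉V N≤x x∈V = <⇒≱ (∈V⇒<N x∈V) N≤x

  N∉V : N ∉ V
  N∉V = N≤⇒∉V ≤-refl

  anchors : List ℕ
  anchors = N ∷ V

  anchor≤N : ∀ {a} → a ∈ anchors → a ≤ N
  anchor≤N (here refl)  = ≤-refl
  anchor≤N (there a∈V) = <⇒≤ (∈V⇒<N a∈V)

  -- T′ uses labels below N for the vertices of G and labels above N for chain vertices;
  -- ℓ′ x is the last-born of x in T′.
  ℓ′ : ℕ → ℕ
  ℓ′ x = suc N + x

  chain : ℕ → ℕ → ℕ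
  chain a k = iter ℓ′ (suc k) a

  N<ℓ′ : ∀ {x} → N < ℓ′ x
  N<ℓ′ {x} = m≤m+n (suc N) x

  ℓ′∉V : ∀ {x} → ℓ′ x ∉ V
  ℓ′∉V = N≤⇒∉V (<⇒≤ N<ℓ′)

  chain-injective : ∀ {a b} i j → a ≤ N → b ≤ N → chain a i ≡ chain b j → i ≡ j
  chain-injective zero    zero    _   _   _  = refl
  chain-injective zero    (suc j) a≤N _   eq =
    contradiction (subst (_≤ N) (+-cancelˡ-≡ (suc N) _ _ eq) a≤N) (<⇒≱ N<ℓ′)
  chain-injective (suc i) zero    _   b≤N eq =
    contradiction (subst (_≤ N) (+-cancelˡ-≡ (suc N) _ _ (sym eq)) b≤N) (<⇒≱ N<ℓ′)
  chain-injective (suc i) (suc j) a≤N b≤N eq =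
    cong suc (chain-injective i j a≤N b≤N (+-cancelˡ-≡ (suc N) _ _ eq))

  lastBit : ℕ → ℕ
  lastBit x with lastBorn (parent x) ≟ x
  ... | yes _ = 1
  ... | no  _ = 0

  lastBit-lastBorn : ∀ {x} → lastBorn (parent x) ≡ x → lastBit x ≡ 1
  lastBit-lastBorn {x} ℓpx≡x with lastBorn (parent x) ≟ x
  ... | yes _     = refl
  ... | no  ℓpx≢x = contradiction ℓpx≡x ℓpx≢x

  lastBit-¬lastBorn : ∀ {x} → lastBorn (parent x) ≢ x → lastBit x ≡ 0
  lastBit-¬lastBorn {x} ℓpx≢x with lastBorn (parent x) ≟ x
  ... | yes ℓpx≡x = contradiction ℓpx≡x ℓpx≢x
  ... | no  _     = refl

  lastBit≤1 : ∀ x → lastBit x ≤ 1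
  lastBit≤1 x with lastBorn (parent x) ≟ x
  ... | yes _ = ≤-refl
  ... | no  _ = z≤n

  -- A vertex x of G is attached at position pos x of the chain of its anchor.  Last-borns
  -- are moved one step down, so that c(u), which starts at the last-born sibling of u,
  -- starts strictly below the attachment point of u.
  pos : ℕ → ℕ
  pos x = depth tree x + lastBit x

  pos-child-mono : ∀ {y x} → Child tree y x → pos x ≤ pos y
  pos-child-mono {y} {x} ch = begin
    depth tree x + lastBit x ≤⟨ +-monoʳ-≤ (depth tree x) (lastBit≤1 x) ⟩
    depth tree x + 1         ≡⟨ +-comm (depth tree x) 1 ⟩
    suc (depth tree x)       ≡⟨ depth-child tree ch ⟨
    depth tree y             ≤⟨ m≤m+n (depth tree y) (lastBit y) ⟩
    pos y                    ∎
    where open ≤-Reasoning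

  M : ℕ
  M = suc (max 0 (map pos V))

  pos<M : ∀ {v} → v ∈ V → pos v < M
  pos<M v∈V = s≤s (All.lookup (xs≤max 0 (map pos V)) (∈-map⁺ pos v∈V))

  above : ℕ → ℕ → ℕ
  above zero    y = N
  above (suc f) y with parent y ∈V?
  ... | yes _ = parent y
  ... | no  _ = above f (parent y)

  -- The nearest proper ancestor of x in T lying in G, or N if there is none.
  anchor : ℕ → ℕ
  anchor x = above (depth tree x) x

  above∈anchors : ∀ f y → above f y ∈ anchors
  above∈anchors zero    y = here refl
  above∈anchors (suc f) y with parent y ∈V?
  ... | yes py∈V = there py∈V
  ... | no  _    = above∈anchors f (parent y)

  anchor∈anchors : ∀ x → anchor x ∈ anchors
  anchor∈anchors x = above∈anchors (depth tree x) x

  above-suc-∈V : ∀ {f y} → parent y ∈ V → above (suc f) y ≡ parent y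
  above-suc-∈V {f} {y} py∈V with parent y ∈V?
  ... | yes _    = refl
  ... | no  py∉V = contradiction py∈V py∉V

  above-suc-∉V : ∀ {f y} → parent y ∉ V → above (suc f) y ≡ above f (parent y)
  above-suc-∉V {f} {y} py∉V with parent y ∈V?
  ... | yes py∈V = contradiction py∈V py∉V
  ... | no  _    = refl

  anchor-child-∈V : ∀ {y x} → Child tree y x → x ∈ V → anchor y ≡ x
  anchor-child-∈V {y} ch@(_ , _ , refl) x∈V =
    trans (cong (λ f → above f y) (depth-child tree ch)) (above-suc-∈V x∈V)

  anchor-child-∉V : ∀ {y x} → Child tree y x → x ∉ V → anchor y ≡ anchor x
  anchor-child-∉V {y} ch@(_ , _ , refl) x∉V =
    trans (cong (λ f → above f y) (depth-child tree ch)) (above-suc-∉V x∉V)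

  anchor-sibling : ∀ {y y′ x} → Child tree y x → Child tree y′ x → anchor y ≡ anchor y′
  anchor-sibling {x = x} ch ch′ with x ∈V?
  ... | yes x∈V = trans (anchor-child-∈V ch x∈V) (sym (anchor-child-∈V ch′ x∈V))
  ... | no  x∉V = trans (anchor-child-∉V ch x∉V) (sym (anchor-child-∉V ch′ x∉V))

  above-descends : ∀ {f y} → y ∈ verts → Depth tree y f →
                   above f y ≡ N ⊎ (above f y ∈ V × depth tree (above f y) < f)
  above-descends {zero}      _  _ = inj₁ refl
  above-descends {suc f} {y} y∈ d with Depth-parent tree d
  ... | y≢root , dp with parent y ∈V?
  ...   | yes py∈V = inj₂ (py∈V , s≤s (≤-reflexive (Depth-unique tree (depth-Depth tree py∈) dp)))
    where
    py∈ : parent y ∈ verts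
    py∈ = parent∈ y y∈ y≢root
  ...   | no  _ with above-descends (parent∈ y y∈ y≢root) dp
  ...     | inj₁ ≡N          = inj₁ ≡N
  ...     | inj₂ (a∈V , d<f) = inj₂ (a∈V , m<n⇒m<1+n d<f)

  anchor-descends : ∀ {v} → v ∈ V → anchor v ≡ N ⊎ (anchor v ∈ V × depth tree (anchor v) < depth tree v)
  anchor-descends v∈V = above-descends (∈V⇒∈T v∈V) (depth-Depth tree (∈V⇒∈T v∈V))

  parent′ : ℕ → ℕ
  parent′ x with x <? N
  ... | yes _ = chain (anchor x) (pos x)
  ... | no  _ = x ∸ suc N

  parent′-< : ∀ {x} → x < N → parent′ x ≡ chain (anchor x) (pos x)
  parent′-< {x} x<N with x <? N
  ... | yes _   = refl
  ... | no  x≮N = contradiction x<N x≮N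

  parent′-≮ : ∀ {x} → ¬ x < N → parent′ x ≡ x ∸ suc N
  parent′-≮ {x} x≮N with x <? N
  ... | yes x<N = contradiction x<N x≮N
  ... | no  _   = refl

  parent′-ℓ′ : ∀ x → parent′ (ℓ′ x) ≡ x
  parent′-ℓ′ x = trans (parent′-≮ (<-asym N<ℓ′)) (m+n∸m≡n (suc N) x)

  verts′ : List ℕ
  verts′ = anchors ++ cartesianProductWith chain anchors (upTo (suc M))

  data Vertex′ : ℕ → Set where
    graphVertex : ∀ {x} → x ∈ V → Vertex′ x
    rootVertex  : Vertex′ N
    chainVertex : ∀ {a j} → a ∈ anchors → j ≤ M → Vertex′ (chain a j)

  vertex′ : ∀ {x} → x ∈ verts′ → Vertex′ x
  vertex′ x∈ with ∈-++⁻ anchors x∈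
  ... | inj₁ (here refl)  = rootVertex
  ... | inj₁ (there x∈V) = graphVertex x∈V
  ... | inj₂ x∈chains with ∈-cartesianProductWith⁻ chain anchors (upTo (suc M)) x∈chains
  ...   | _ , _ , a∈ , j∈ , refl = chainVertex a∈ (≤-pred (∈-upTo⁻ j∈))

  anchor∈′ : ∀ {a} → a ∈ anchors → a ∈ verts′
  anchor∈′ = ∈-++⁺ˡ

  graph∈′ : ∀ {v} → v ∈ V → v ∈ verts′
  graph∈′ = anchor∈′ ∘ there

  chain∈′ : ∀ {a j} → a ∈ anchors → j ≤ M → chain a j ∈ verts′
  chain∈′ a∈ j≤M = ∈-++⁺ʳ anchors (∈-cartesianProductWith⁺ chain a∈ (∈-upTo⁺ (s≤s j≤M)))

  parent∈′ : ∀ x → x ∈ verts′ → x ≢ N → parent′ x ∈ verts′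
  parent∈′ x x∈ x≢N with vertex′ x∈
  ... | graphVertex x∈V =
    subst (_∈ verts′) (sym (parent′-< (∈V⇒<N x∈V))) (chain∈′ (anchor∈anchors x) (<⇒≤ (pos<M x∈V)))
  ... | rootVertex = contradiction refl x≢N
  ... | chainVertex {a} {zero}  a∈ _   = subst (_∈ verts′) (sym (parent′-ℓ′ a)) (anchor∈′ a∈)
  ... | chainVertex {a} {suc j} a∈ j<M =
    subst (_∈ verts′) (sym (parent′-ℓ′ (chain a j))) (chain∈′ a∈ (<⇒≤ j<M))

  Reaches : ℕ → Set
  Reaches x = ∃ λ k → iter parent′ k x ≡ N

  reaches-via : ∀ k {x y} → iter parent′ k x ≡ y → Reaches y → Reaches x
  reaches-via k {x} x↦y (m , y↦N) =
    m + k , trans (iter-+ parent′ m k x) (trans (cong (iter parent′ m) x↦y) y↦N)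

  chain-climb : ∀ a k → iter parent′ (suc k) (chain a k) ≡ a
  chain-climb a k = iter-cancel {ℓ′} {parent′} parent′-ℓ′ (suc k) a

  graph-climb : ∀ {v} → v ∈ V → iter parent′ (suc (suc (pos v))) v ≡ anchor v
  graph-climb {v} v∈V = begin
    iter parent′ (suc (suc (pos v))) v                    ≡⟨ iter-suc parent′ (suc (pos v)) v ⟩
    iter parent′ (suc (pos v)) (parent′ v)                ≡⟨ cong (iter parent′ (suc (pos v))) (parent′-< (∈V⇒<N v∈V)) ⟩
    iter parent′ (suc (pos v)) (chain (anchor v) (pos v)) ≡⟨ chain-climb (anchor v) (pos v) ⟩
    anchor v                                              ∎
    where open ≡-Reasoning

  graph-reaches : ∀ n {v} → v ∈ V → depth tree v ≤ n → Reaches v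
  graph-reaches n {v} v∈V d≤n with anchor-descends v∈V
  ... | inj₁ anchor≡N = reaches-via (suc (suc (pos v))) (trans (graph-climb v∈V) anchor≡N) (0 , refl)
  graph-reaches zero    v∈V d≤n | inj₂ (_ , d<) = contradiction (≤-trans d< d≤n) λ ()
  graph-reaches (suc n) {v} v∈V d≤n | inj₂ (a∈V , d<) =
    reaches-via (suc (suc (pos v))) (graph-climb v∈V) (graph-reaches n a∈V (≤-pred (≤-trans d< d≤n)))

  anchor-reaches : ∀ {a} → a ∈ anchors → Reaches a
  anchor-reaches (here refl)  = 0 , refl
  anchor-reaches (there a∈V) = graph-reaches _ a∈V ≤-refl

  reaches′ : ∀ x → x ∈ verts′ → Reaches x
  reaches′ x x∈ with vertex′ x∈
  ... | graphVertex x∈V          = graph-reaches _ x∈V ≤-refl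
  ... | rootVertex               = 0 , refl
  ... | chainVertex {a} {j} a∈ _ = reaches-via (suc j) (chain-climb a j) (anchor-reaches a∈)

  T′ : RootedTree
  T′ = record
    { verts     = verts′
    ; root      = N
    ; parent    = parent′
    ; root∈     = anchor∈′ (here refl)
    ; parent∈   = parent∈′
    ; reachRoot = reaches′
    }

  ℓ′-child : ∀ {x} → ℓ′ x ∈ verts′ → Child T′ (ℓ′ x) x
  ℓ′-child {x} ℓ′x∈ = ℓ′x∈ , >⇒≢ N<ℓ′ , parent′-ℓ′ x

  chain-end-leaf : ∀ {a y} → a ∈ anchors → ¬ Child T′ y (chain a M)
  chain-end-leaf {a} {y} a∈ (y∈ , y≢N , py≡) with vertex′ y∈
  ... | graphVertex y∈V =
    <-irrefl (chain-injective (pos y) M (anchor≤N (anchor∈anchors y)) (anchor≤N a∈)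
                (trans (sym (parent′-< (∈V⇒<N y∈V))) py≡))
             (pos<M y∈V)
  ... | rootVertex = y≢N refl
  ... | chainVertex {b} {zero} b∈ _ =
    contradiction (subst (_≤ N) (trans (sym (parent′-ℓ′ b)) py≡) (anchor≤N b∈)) (<⇒≱ N<ℓ′)
  ... | chainVertex {b} {suc j} b∈ j<M =
    <-irrefl (chain-injective j M (anchor≤N b∈) (anchor≤N a∈)
                (trans (sym (parent′-ℓ′ (chain b j))) py≡))
             j<M

  ℓ′∈verts′ : ∀ {x y} → x ∈ verts′ → Child T′ y x → ℓ′ x ∈ verts′
  ℓ′∈verts′ {x} x∈ y-child with vertex′ x∈
  ... | graphVertex x∈V = chain∈′ (there x∈V) z≤n
  ... | rootVertex      = chain∈′ (here refl) z≤n
  ... | chainVertex a∈ j≤M with m≤n⇒m<n∨m≡n j≤M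
  ...   | inj₁ j<M = chain∈′ a∈ j<M
  ...   | inj₂ refl = contradiction y-child (chain-end-leaf a∈)

  lastBorn-child′ : ∀ v → NonLeaf T′ v → Child T′ (ℓ′ v) v
  lastBorn-child′ v (v∈ , _ , y-child) = ℓ′-child (ℓ′∈verts′ v∈ y-child)

  IsLastBorn′ : ℕ → Set
  IsLastBorn′ x = ∃ λ w → NonLeaf T′ w × ℓ′ w ≡ x

  ℓ′-isLastBorn : ∀ {x} → ℓ′ x ∈ verts′ → IsLastBorn′ (ℓ′ x)
  ℓ′-isLastBorn {x} ℓ′x∈ = x , (Child-parent∈ T′ ch , ℓ′ x , ch) , refl
    where
    ch : Child T′ (ℓ′ x) x
    ch = ℓ′-child ℓ′x∈

  segment segment-below : ℕ → ℕ → ℕ → List ℕ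
  segment a i d = chain a i ∷ segment-below a i d
  segment-below a i zero    = []
  segment-below a i (suc d) = segment a (suc i) d

  -- Keeps the vertices of G and replaces the others by chain segments: the current position
  -- is i on the chain of a, and each vertex x of G is reached by descending that chain down
  -- to position pos x.
  walk : ℕ → ℕ → List ℕ → List ℕ
  walk a i [] = []
  walk a i (x ∷ xs) with x ∈V?
  ... | yes _ = segment a i (pos x ∸ i) ++ x ∷ walk x 0 xs
  ... | no  _ = walk a i xs

  c′ : ℕ → List ℕ
  c′ x with x ∈V?
  ... | yes _ = walk (anchor x) (suc (pos x)) (c x)
  ... | no  _ = []

  c′-∈V : ∀ {x} → x ∈ V → c′ x ≡ walk (anchor x) (suc (pos x)) (c x)
  c′-∈V {x} x∈V with x ∈V?
  ... | yes _   = refl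
  ... | no  x∉V = contradiction x∈V x∉V

  c′-∉V : ∀ {x} → x ∉ V → c′ x ≡ []
  c′-∉V {x} x∉V with x ∈V?
  ... | yes x∈V = contradiction x∈V x∉V
  ... | no  _   = refl

  filter-segment : ∀ a i d → filter _∈V? (segment a i d) ≡ []
  filter-segment a i zero    = filter-reject _∈V? ℓ′∉V
  filter-segment a i (suc d) = trans (filter-reject _∈V? ℓ′∉V) (filter-segment a (suc i) d)

  filter-walk : ∀ xs a i → filter _∈V? (walk a i xs) ≡ filter _∈V? xs
  filter-walk []       a i = refl
  filter-walk (x ∷ xs) a i with x ∈V?
  ... | yes x∈V = begin
    filter _∈V? (segment a i (pos x ∸ i) ++ x ∷ walk x 0 xs)
      ≡⟨ filter-++ _∈V? (segment a i (pos x ∸ i)) _ ⟩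
    filter _∈V? (segment a i (pos x ∸ i)) ++ filter _∈V? (x ∷ walk x 0 xs)
      ≡⟨ cong₂ _++_ (filter-segment a i (pos x ∸ i)) (filter-accept _∈V? x∈V) ⟩
    x ∷ filter _∈V? (walk x 0 xs)
      ≡⟨ cong (x ∷_) (filter-walk xs x 0) ⟩
    x ∷ filter _∈V? xs
      ∎
    where open ≡-Reasoning
  ... | no  x∉V = filter-walk xs a i

  c′-filter : ∀ {u} → u ∈ V → filter _∈V? (c′ u) ≡ filter _∈V? (c u)
  c′-filter u∈V = trans (cong (filter _∈V?) (c′-∈V u∈V)) (filter-walk (c _) _ _)

  segment-path : ∀ {a x r} d i → a ∈ anchors → i + d < M → Child T′ x (chain a (i + d)) →
                 DownPath T′ (x ∷ r) → DownPath T′ (segment a i d ++ x ∷ r)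
  segment-path {a} {x} zero    i a∈ _     hang p =
    step (subst (Child T′ x ∘ chain a) (+-identityʳ i) hang) p
  segment-path {a} {x} (suc d) i a∈ i+d<M hang p =
    step (ℓ′-child (chain∈′ a∈ (≤-trans (m≤m+n (suc i) d) (<⇒≤ bound))))
         (segment-path d (suc i) a∈ bound (subst (Child T′ x ∘ chain a) (+-suc i d) hang) p)
    where
    bound : suc i + d < M
    bound = subst (_< M) (+-suc i d) i+d<M

  graph-path : ∀ {x ys} → x ∈ V → BranchFrom T′ (ℓ′ x) ys → DownPath T′ (x ∷ ys)
  graph-path {ys = []}    x∈V _          = single (graph∈′ x∈V)
  graph-path {ys = _ ∷ _} x∈V (refl , p) = step (ℓ′-child (DownPath-∈ T′ p (here refl))) p

  walk-branch : ∀ {i x xs} → DownPath tree (x ∷ xs) → i ≤ pos x →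
                BranchFrom T′ (chain (anchor x) i) (walk (anchor x) i (x ∷ xs))
  walk-below : ∀ {x xs} → DownPath tree (x ∷ xs) → x ∈ V → BranchFrom T′ (ℓ′ x) (walk x 0 xs)

  walk-branch {i} {x} {xs} p i≤pos with x ∈V?
  ... | yes x∈V =
    refl , segment-path (pos x ∸ i) i (anchor∈anchors x) bound hang (graph-path x∈V (walk-below p x∈V))
    where
    i+[pos∸i]≡pos : i + (pos x ∸ i) ≡ pos x
    i+[pos∸i]≡pos = m+[n∸m]≡n i≤pos
    bound : i + (pos x ∸ i) < M
    bound = subst (_< M) (sym i+[pos∸i]≡pos) (pos<M x∈V)
    hang : Child T′ x (chain (anchor x) (i + (pos x ∸ i)))
    hang = graph∈′ x∈V , <⇒≢ (∈V⇒<N x∈V) ,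
           trans (parent′-< (∈V⇒<N x∈V)) (cong (chain (anchor x)) (sym i+[pos∸i]≡pos))
  ... | no x∉V with p
  ...   | single _  = tt
  ...   | step ch q =
    subst (λ a → BranchFrom T′ (chain a i) (walk a i xs)) (anchor-child-∉V ch x∉V)
      (walk-branch q (≤-trans i≤pos (pos-child-mono ch)))

  walk-below (single _)  _   = tt
  walk-below {xs = xs} (step ch q) x∈V =
    subst (λ a → BranchFrom T′ (chain a 0) (walk a 0 xs)) (anchor-child-∈V ch x∈V) (walk-branch q z≤n)

  -- c(v) starts at the last-born sibling L of v.
  c-start : ∀ {v L rest} → v ∈ V → c v ≡ L ∷ rest →
            DownPath tree (L ∷ rest) × anchor L ≡ anchor v × pos L ≡ suc (pos v)
  c-start {v} {L} {rest} v∈V c≡ = proj₂ branch , anchor-sibling L-child v-child , pos-L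
    where
    v∈T : v ∈ verts
    v∈T = ∈V⇒∈T v∈V
    ordinary : v ≢ root × ¬ IsLastBorn v
    ordinary = c-nonempty B v∈T (subst (L ∈_) (sym c≡) (here refl))
    v-child : Child tree v (parent v)
    v-child = v∈T , proj₁ ordinary , refl
    parent-nonLeaf : NonLeaf tree (parent v)
    parent-nonLeaf = parent∈ v v∈T (proj₁ ordinary) , v , v-child
    branch : L ≡ lastBorn (parent v) × DownPath tree (L ∷ rest)
    branch = subst (BranchFrom tree _) c≡ (c-branch v v∈T (proj₁ ordinary) (proj₂ ordinary))
    L-child : Child tree L (parent v)
    L-child = subst (λ y → Child tree y (parent v)) (sym (proj₁ branch)) (lastBorn-child _ parent-nonLeaf)
    L-bit : lastBit L ≡ 1
    L-bit = lastBit-lastBorn (trans (cong lastBorn (proj₂ (proj₂ L-child))) (sym (proj₁ branch)))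
    v-bit : lastBit v ≡ 0
    v-bit = lastBit-¬lastBorn λ ℓpv≡v → proj₂ ordinary (parent v , parent-nonLeaf , ℓpv≡v)
    same-depth : depth tree L ≡ depth tree v
    same-depth = trans (depth-child tree L-child) (sym (depth-child tree v-child))
    pos-L : pos L ≡ suc (pos v)
    pos-L = begin
      depth tree L + lastBit L ≡⟨ cong₂ _+_ same-depth L-bit ⟩
      depth tree v + 1         ≡⟨ +-comm (depth tree v) 1 ⟩
      suc (depth tree v)       ≡⟨ cong suc (+-identityʳ (depth tree v)) ⟨
      suc (depth tree v + 0)   ≡⟨ cong (suc ∘ (depth tree v +_)) v-bit ⟨
      suc (pos v)              ∎
      where open ≡-Reasoning

  c′-branch-∈V : ∀ {v} → v ∈ V → BranchFrom T′ (ℓ′ (parent′ v)) (c′ v)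
  c′-branch-∈V {v} v∈V =
    subst₂ (BranchFrom T′) (cong ℓ′ (sym (parent′-< (∈V⇒<N v∈V)))) (sym (c′-∈V v∈V)) walk-from
    where
    walk-from : BranchFrom T′ (chain (anchor v) (suc (pos v))) (walk (anchor v) (suc (pos v)) (c v))
    walk-from with c v in c≡
    ... | []       = tt
    ... | L ∷ rest with c-start v∈V c≡
    ...   | path , anchor-L , pos-L =
      subst (λ a → BranchFrom T′ (chain a (suc (pos v))) (walk a (suc (pos v)) (L ∷ rest))) anchor-L
        (walk-branch path (≤-reflexive (sym pos-L)))

  c-empty′ : ∀ v → v ∈ verts′ → v ≡ N ⊎ IsLastBorn′ v → c′ v ≡ []
  c-empty′ v _ (inj₁ refl)           = c′-∉V N∉V
  c-empty′ v _ (inj₂ (_ , _ , refl)) = c′-∉V ℓ′∉V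

  c-branch′ : ∀ v → v ∈ verts′ → v ≢ N → ¬ IsLastBorn′ v → BranchFrom T′ (ℓ′ (parent′ v)) (c′ v)
  c-branch′ v _ _ _ = case v ∈V? of λ where
    (yes v∈V) → c′-branch-∈V v∈V
    (no  v∉V) → subst (BranchFrom T′ _) (sym (c′-∉V v∉V)) tt

  B′ : BurlingTree
  B′ = record
    { tree           = T′
    ; lastBorn       = ℓ′
    ; lastBorn-child = lastBorn-child′
    ; c              = c′
    ; c-empty        = c-empty′
    ; c-branch       = c-branch′
    }

  derived′ : DerivedFrom G B′
  derived′ = (λ _ → graph∈′) , λ u v u∈V v∈V →
    mk⇔ (∈-filter-≡ _∈V? (sym (c′-filter u∈V)) v∈V) (∈-filter-≡ _∈V? (c′-filter u∈V) v∈V)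
      ⇔-∘ proj₂ D u v u∈V v∈V

  graph⇔ordinary : ∀ v → v ∈ verts′ → v ∈ V ⇔ (v ≢ N × ¬ IsLastBorn′ v)
  graph⇔ordinary v v∈′ = mk⇔ graph⇒ordinary (ordinary⇒graph (vertex′ v∈′))
    where
    graph⇒ordinary : v ∈ V → v ≢ N × ¬ IsLastBorn′ v
    graph⇒ordinary v∈V = (λ v≡N → N∉V (subst (_∈ V) v≡N v∈V)) ,
                         (λ (_ , _ , ℓ′w≡v) → ℓ′∉V (subst (_∈ V) (sym ℓ′w≡v) v∈V))
    ordinary⇒graph : ∀ {x} → Vertex′ x → x ≢ N × ¬ IsLastBorn′ x → x ∈ V
    ordinary⇒graph (graphVertex x∈V)   _           = x∈V
    ordinary⇒graph rootVertex          (x≢N , _)   = contradiction refl x≢N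
    ordinary⇒graph (chainVertex a∈ j≤M) (_ , ¬lb) = contradiction (ℓ′-isLastBorn (chain∈′ a∈ j≤M)) ¬lb

  same-order : ∀ {u v w} → Arc u v → Arc u w → Precedes (c u) v w ⇔ Precedes (c′ u) v w
  same-order {u} {v} {w} uv uw =
    mk⇔ (precedes-filter-≡ _∈V? (sym (c′-filter u∈V)) v∈V w∈V)
        (precedes-filter-≡ _∈V? (c′-filter u∈V) v∈V w∈V)
    where
    u∈V : u ∈ V
    u∈V = proj₁ (arc-in u v uv)
    v∈V : v ∈ V
    v∈V = proj₂ (arc-in u v uv)
    w∈V : w ∈ V
    w∈V = proj₂ (arc-in u w uw)

lemma3p5 : (G : OrientedGraph) (B : BurlingTree) → DerivedFrom G B →
    Σ BurlingTree λ B' → DerivedFrom G B' ×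
      (∀ v → v ∈ RootedTree.verts (BurlingTree.tree B') →
        (v ∈ OrientedGraph.V G ⇔
          (v ≢ RootedTree.root (BurlingTree.tree B') × ¬ BurlingTree.IsLastBorn B' v))) ×
      (∀ u v → OrientedGraph.Arc G u v →
        (TopArc G B u v ⇔ TopArc G B' u v) × (BottomArc G B u v ⇔ BottomArc G B' u v))
lemma3p5 G B D =
  B′ , derived′ , graph⇔ordinary ,
  λ u v uv → TopArc-transfer {G} {B} {B′} D derived′ same-order ,
             BottomArc-transfer {G} {B} {B′} D derived′ same-order
  where open Normalisation G B D
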